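{- Assume the following statement holds: for all integers $n \ge 3$ and $2 \le k < n/2$, if there exists $j \in \mathbb{Z}_n$ such that $d(u_0,v_j) = D$, where $D$ is the diameter of $GP(n,k)$, then either $n = 4m$ and $k = 2m-1$ for some integer $m \ge 3$, or $(n,k) \in \{(5,2),(7,2),(7,3)\}$. Then for all integers $n \geq 3$ and $1 \leq k < n/2$, the generalized Petersen graph $GP(n,k)$ is $D$-distance-balanced, where $D$ is its diameter.
   Context: The generalized Petersen graph $GP(n,k)$ has vertex set $\{u_i \mid i \in \mathbb{Z}_n\} \cup \{v_i \mid i \in \mathbb{Z}_n\}$ and edges $u_iu_{i+1}$, $v_iv_{i+k}$, $u_iv_i$ for $i \in \mathbb{Z}_n$; $d$ denotes graph distance. For vertices $u,v$, $W_{uv} = \{w \mid d(u,w) < d(v,w)\}$. For a positive integer $\ell$, a connected graph of diameter at least $\ell$ is $\ell$-distance-balanced if $|W_{uv}| = |W_{vu}|$ for all $u,v$ with $d(u,v)=\ell$. -}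

module Defs where

open import Data.Nat using (ℕ; zero; suc; _+_; _*_; _≤_; _<_; s≤s; z≤n; _≡ᵇ_; _<ᵇ_)
open import Data.Nat.DivMod using (_%_)
open import Data.Fin using (Fin; toℕ) renaming (zero to fzero)
open import Data.Bool using (Bool; true; false; _∧_; _∨_)
open import Data.List using (List; []; _∷_; _++_; map; length; filterᵇ; foldr; allFin)
open import Data.Bool.ListAction using (any)
open import Data.Product using (_×_)
open import Relation.Binary.PropositionalEquality using (_≡_)

-- Reduction modulo n (for n = 0 the value is left unchanged; irrelevant since V 0 is empty).
modN : ℕ → ℕ → ℕ
modN zero a = a
modN (suc m) a = a % suc m

-- Vertices of GP(n,k): outer vertices u_i and inner vertices v_i, i ∈ ℤ_n (= Fin n).
data V (n : ℕ) : Set where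
  u : Fin n → V n
  v : Fin n → V n

vertices : (n : ℕ) → List (V n)
vertices n = map u (allFin n) ++ map v (allFin n)

_==_ : ∀ {n} → V n → V n → Bool
u i == u j = toℕ i ≡ᵇ toℕ j
v i == v j = toℕ i ≡ᵇ toℕ j
u _ == v _ = false
v _ == u _ = false

shift : (n s : ℕ) → Fin n → Fin n → Bool
shift n s i j = modN n (toℕ i + s) ≡ᵇ toℕ j

adj : (n k : ℕ) → V n → V n → Bool
adj n k (u i) (u j) = shift n 1 i j ∨ shift n 1 j i
adj n k (v i) (v j) = shift n k i j ∨ shift n k j i
adj n k (u i) (v j) = toℕ i ≡ᵇ toℕ j
adj n k (v i) (u j) = toℕ i ≡ᵇ toℕ j

reach : (n k m : ℕ) → V n → V n → Bool
reach n k zero x y = x == y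
reach n k (suc m) x y =
  reach n k m x y ∨ any (λ z → reach n k m x z ∧ adj n k z y) (vertices n)

-- Least m ≤ bound (searching from start) with reach m x y; returns start + bound + 1 if none.
firstReach : (n k start bound : ℕ) → V n → V n → ℕ
firstReach n k start zero x y with reach n k start x y
... | true = start
... | false = suc start
firstReach n k start (suc b) x y with reach n k start x y
... | true = start
... | false = firstReach n k (suc start) b x y

-- A graph on 2n vertices has all finite distances ≤ 2n - 1, so searching m ∈ [0, 2n]
-- is exhaustive; the value 2n+1 signals "unreachable" (never happens when connected).
dist : (n k : ℕ) → V n → V n → ℕ
dist n k x y = firstReach n k 0 (2 * n) x y

maxℕ : List ℕ → ℕ
maxℕ = foldr (λ a b → Data.Nat._⊔_ a b) 0
  where import Data.Nat

diameter : (n k : ℕ) → ℕ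
diameter n k = maxℕ (Data.List.concatMap (λ x → map (dist n k x) (vertices n)) (vertices n))
  where import Data.List

Connected : (n k : ℕ) → Set
Connected n k = ∀ (x y : V n) → reach n k (2 * n) x y ≡ true

W : (n k : ℕ) → V n → V n → ℕ
W n k x y = length (filterᵇ (λ w → dist n k x w <ᵇ dist n k y w) (vertices n))

DistanceBalanced : (ℓ n k : ℕ) → Set
DistanceBalanced ℓ n k =
  Connected n k × ℓ ≤ diameter n k ×
  (∀ (x y : V n) → dist n k x y ≡ ℓ → W n k x y ≡ W n k y x)

u₀ : ∀ {n} → 3 ≤ n → V n
u₀ (s≤s _) = u fzero

-- An automorphism φ of GP(n,k) with φ x = y and φ y = x gives |W_xy| = |W_yx|. The reflections
-- i ↦ c - i of ℤ_n act on both rims as automorphisms, which settles all pairs on one rim, and they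
-- move any pair (u_a, v_b) at distance D to a pair (u_0, v_j). So only u_0 and the v_j with
-- d(u_0, v_j) = D remain. For k = 1 the map u_i ↔ v_(j-i) exchanges them; for k ≥ 2 the hypothesis
-- leaves GP(4m, 2m-1) and three small graphs, which are checked by evaluation. In GP(4m, 2m-1) we
-- have k² ≡ 1 (mod 4m), so u_i ↔ v_(j+ei) is an automorphism for e = ±k as soon as (1 + e) j ≡ 0:
-- e = k handles every even j, and e = -k handles j ∈ {m, 3m} when m is odd. Every other odd j has
-- d(u_0, v_j) ≤ m, whereas D ≥ m + 1: reducing indices modulo 2m maps the graph onto the prism
-- over a 2m-cycle, where u_0 and v_m are at distance m + 1.

module Submission where


open import Defs
open import Data.Nat using (ℕ; _+_; _*_; _∸_; _≤_; _<_)
open import Data.Fin using (Fin)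
open import Data.Product using (Σ; _×_; _,_)
open import Data.Sum using (_⊎_)
open import Relation.Binary.PropositionalEquality using (_≡_)

open import Data.Bool using (Bool; true; false; T; not; _∨_; if_then_else_)
open import Data.Bool.ListAction using (all)
open import Data.Bool.Properties using (T-∨; T-∧; T-≡; ∨-comm)
open import Data.Empty using (⊥; ⊥-elim)
open import Data.Fin using (toℕ) renaming (zero to fzero; suc to fsuc)
open import Data.Fin.Permutation using (Permutation′; permutation; _⟨$⟩ʳ_)
open import Data.Fin.Properties using (toℕ-injective; toℕ-fromℕ<; toℕ<n)
open import Data.List using (List; []; _∷_; _++_; map; length; filterᵇ; allFin; tabulate)
open import Data.List.Membership.Propositional using (_∈_; lose)
open import Data.List.Membership.Propositional.Properties using (∈-map⁺; ∈-++⁺ˡ; ∈-++⁺ʳ; ∈-allFin; ∈-concatMap⁺)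
open import Data.List.Properties using (map-tabulate)
open import Data.List.Relation.Unary.All as All using ()
open import Data.List.Relation.Unary.All.Properties using (all⁺)
open import Data.List.Relation.Unary.Any using (here; there; satisfied)
open import Data.List.Relation.Unary.Any.Properties using (any⁺; any⁻)
open import Data.Nat using (NonZero; zero; suc; s≤s; z≤n; _≤′_; ≤′-refl; ≤′-step; _⊓_; _≡ᵇ_; _<ᵇ_; _≤?_; _≟_)
open import Data.Nat.DivMod using (_%_; _/_; m≡m%n+[m/n]*n; _mod_; m%n<n; m%n%n≡m%n; [m+kn]%n≡m%n; m<n⇒m%n≡m; n%n≡0; %-distribˡ-+; %-distribˡ-*; m∣n⇒o%n%m≡o%m)
open import Data.Nat.Divisibility using (_∣_; divides; ∣⇒≤)
open import Data.Nat.Properties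
open import Algebra.Properties.CommutativeMonoid.Sum +-0-commutativeMonoid using (sum; sum-permute)
open import Data.Nat.Tactic.RingSolver using (solve-∀)
open import Data.Product using (∃; proj₁; proj₂)
open import Data.Sum using (inj₁; inj₂)
open import Function using (_∘_; Equivalence)
open import Relation.Binary.Bundles using (Setoid)
import Relation.Binary.Reasoning.Setoid as SetoidReasoning
open import Relation.Binary.PropositionalEquality using (_≢_; refl; sym; trans; cong; cong₂; subst; subst₂; module ≡-Reasoning)
open import Relation.Nullary using (yes; no)

∨-introˡ : ∀ {a} b → T a → T (a ∨ b)
∨-introˡ {a} b = Equivalence.from (T-∨ {a} {b}) ∘ inj₁

∨-introʳ : ∀ a {b} → T b → T (a ∨ b)
∨-introʳ a {b} = Equivalence.from (T-∨ {a} {b}) ∘ inj₂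

∨-elim : ∀ a {b} → T (a ∨ b) → T a ⊎ T b
∨-elim a {b} = Equivalence.to (T-∨ {a} {b})

T-injective : ∀ {a b} → (T a → T b) → (T b → T a) → a ≡ b
T-injective {false} {false} _ _ = refl
T-injective {false} {true}  _ g = ⊥-elim (g _)
T-injective {true}  {false} f _ = ⊥-elim (f _)
T-injective {true}  {true}  _ _ = refl

T-not-elim : ∀ b → T (not b) → T b → ⊥
T-not-elim true () _
T-not-elim false _ ()

m*m%[1+m]≡1%[1+m] : ∀ m → (m * m) % suc m ≡ 1 % suc m
m*m%[1+m]≡1%[1+m] zero = refl
m*m%[1+m]≡1%[1+m] (suc p) = trans (cong (_% suc (suc p)) (square p)) ([m+kn]%n≡m%n 1 p (suc (suc p)))
  where
  square : ∀ p → suc p * suc p ≡ 1 + p * suc (suc p)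
  square = solve-∀

parity : ∀ n → (∃ λ t → n ≡ 2 * t) ⊎ (∃ λ t → n ≡ suc (2 * t))
parity zero = inj₁ (0 , refl)
parity (suc n) with parity n
... | inj₁ (t , refl) = inj₂ (t , refl)
... | inj₂ (t , refl) = inj₁ (suc t , cong suc (sym (+-suc t (t + 0))))

cyclicNorm : ℕ → ℕ → ℕ
cyclicNorm M y = y ⊓ (M ∸ y)

Near : ℕ → ℕ → Set
Near a b = a ≤ suc b × b ≤ suc a

cyclicNorm-suc : ∀ M x → suc x < M → Near (cyclicNorm M x) (cyclicNorm M (suc x))
cyclicNorm-suc M x sx<M = subst (λ d → Near (x ⊓ d) (cyclicNorm M (suc x))) (sym (+-∸-assoc 1 (<⇒≤ sx<M)))
  ( ⊓-monoˡ-≤ (suc (M ∸ suc x)) (m≤n⇒m≤1+n (n≤1+n x))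
  , ⊓-monoʳ-≤ (suc x) (m≤n⇒m≤1+n (n≤1+n (M ∸ suc x))) )

cyclicNorm-last : ∀ M x → suc x ≡ M → Near (cyclicNorm M x) (cyclicNorm M 0)
cyclicNorm-last M x refl = subst (λ d → x ⊓ d ≤ 1) (sym (m+n∸n≡m 1 x)) (m⊓n≤n x 1) , z≤n

cyclicNorm-%-suc : ∀ M .{{_ : NonZero M}} r → Near (cyclicNorm M (r % M)) (cyclicNorm M (suc r % M))
cyclicNorm-%-suc M r with m≤n⇒m<n∨m≡n (m%n<n r M)
... | inj₁ sx<M = subst (λ y → Near (cyclicNorm M (r % M)) (cyclicNorm M y))
        (sym (trans suc-% (m<n⇒m%n≡m sx<M))) (cyclicNorm-suc M (r % M) sx<M)
  where
  suc-% : suc r % M ≡ suc (r % M) % M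
  suc-% = trans (cong (λ t → suc t % M) (m≡m%n+[m/n]*n r M)) ([m+kn]%n≡m%n (suc (r % M)) (r / M) M)
... | inj₂ sx≡M = subst (λ y → Near (cyclicNorm M (r % M)) (cyclicNorm M y))
        (sym (trans suc-% (trans (cong (_% M) sx≡M) (n%n≡0 M)))) (cyclicNorm-last M (r % M) sx≡M)
  where
  suc-% : suc r % M ≡ suc (r % M) % M
  suc-% = trans (cong (λ t → suc t % M) (m≡m%n+[m/n]*n r M)) ([m+kn]%n≡m%n (suc (r % M)) (r / M) M)

count : ∀ {A : Set} → (A → Bool) → List A → ℕ
count P xs = length (filterᵇ P xs)

count-∷ : ∀ {A : Set} (P : A → Bool) x xs → count P (x ∷ xs) ≡ (if P x then 1 else 0) + count P xs
count-∷ P x xs with P x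
... | true = refl
... | false = refl

count-++ : ∀ {A : Set} (P : A → Bool) xs ys → count P (xs ++ ys) ≡ count P xs + count P ys
count-++ P [] ys = refl
count-++ P (x ∷ xs) ys = begin
  count P (x ∷ xs ++ ys)                          ≡⟨ count-∷ P x (xs ++ ys) ⟩
  (if P x then 1 else 0) + count P (xs ++ ys)      ≡⟨ cong ((if P x then 1 else 0) +_) (count-++ P xs ys) ⟩
  (if P x then 1 else 0) + (count P xs + count P ys) ≡⟨ +-assoc (if P x then 1 else 0) _ _ ⟨
  (if P x then 1 else 0) + count P xs + count P ys ≡⟨ cong (_+ count P ys) (count-∷ P x xs) ⟨
  count P (x ∷ xs) + count P ys                    ∎
  where open ≡-Reasoning

count-map : ∀ {A B : Set} (P : B → Bool) (f : A → B) xs → count P (map f xs) ≡ count (P ∘ f) xs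
count-map P f [] = refl
count-map P f (x ∷ xs) = begin
  count P (f x ∷ map f xs)                        ≡⟨ count-∷ P (f x) (map f xs) ⟩
  (if P (f x) then 1 else 0) + count P (map f xs) ≡⟨ cong ((if P (f x) then 1 else 0) +_) (count-map P f xs) ⟩
  (if P (f x) then 1 else 0) + count (P ∘ f) xs   ≡⟨ count-∷ (P ∘ f) x xs ⟨
  count (P ∘ f) (x ∷ xs)                          ∎
  where open ≡-Reasoning

count-cong : ∀ {A : Set} {P Q : A → Bool} → (∀ x → P x ≡ Q x) → ∀ xs → count P xs ≡ count Q xs
count-cong E [] = refl
count-cong {P = P} {Q} E (x ∷ xs) = begin
  count P (x ∷ xs)                         ≡⟨ count-∷ P x xs ⟩
  (if P x then 1 else 0) + count P xs      ≡⟨ cong₂ (λ b c → (if b then 1 else 0) + c) (E x) (count-cong E xs) ⟩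
  (if Q x then 1 else 0) + count Q xs      ≡⟨ count-∷ Q x xs ⟨
  count Q (x ∷ xs)                         ∎
  where open ≡-Reasoning


count-allFin : ∀ m (P : Fin m → Bool) → count P (allFin m) ≡ sum (λ i → if P i then 1 else 0)
count-allFin zero P = refl
count-allFin (suc m) P = begin
  count P (fzero ∷ tabulate fsuc)                         ≡⟨ count-∷ P fzero (tabulate fsuc) ⟩
  (if P fzero then 1 else 0) + count P (tabulate fsuc)    ≡⟨ cong (λ xs → (if P fzero then 1 else 0) + count P xs) (map-tabulate (λ i → i) fsuc) ⟨
  (if P fzero then 1 else 0) + count P (map fsuc (allFin m)) ≡⟨ cong ((if P fzero then 1 else 0) +_) (count-map P fsuc (allFin m)) ⟩
  (if P fzero then 1 else 0) + count (P ∘ fsuc) (allFin m) ≡⟨ cong ((if P fzero then 1 else 0) +_) (count-allFin m (P ∘ fsuc)) ⟩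
  sum (λ i → if P i then 1 else 0)                        ∎
  where open ≡-Reasoning

count-permute : ∀ {m} (π : Permutation′ m) (P : Fin m → Bool) →
  count P (allFin m) ≡ count (P ∘ (π ⟨$⟩ʳ_)) (allFin m)
count-permute {m} π P = begin
  count P (allFin m)                          ≡⟨ count-allFin m P ⟩
  sum (λ i → if P i then 1 else 0)            ≡⟨ sum-permute _ π ⟩
  sum (λ i → if P (π ⟨$⟩ʳ i) then 1 else 0)  ≡⟨ count-allFin m (P ∘ (π ⟨$⟩ʳ_)) ⟨
  count (P ∘ (π ⟨$⟩ʳ_)) (allFin m)           ∎
  where open ≡-Reasoning

count-vertices : ∀ {n} (P : V n → Bool) → count P (vertices n) ≡ count (P ∘ u) (allFin n) + count (P ∘ v) (allFin n)
count-vertices {n} P = trans (count-++ P (map u (allFin n)) (map v (allFin n)))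
  (cong₂ _+_ (count-map P u (allFin n)) (count-map P v (allFin n)))

onRims : ∀ {n} → Bool → (Fin n → Fin n) → V n → V n
onRims false σ (u i) = u (σ i)
onRims false σ (v i) = v (σ i)
onRims true  σ (u i) = v (σ i)
onRims true  σ (v i) = u (σ i)

count-onRims : ∀ {n} exchange (π : Permutation′ n) (P : V n → Bool) →
  count P (vertices n) ≡ count (P ∘ onRims exchange (π ⟨$⟩ʳ_)) (vertices n)
count-onRims {n} false π P = begin
  count P (vertices n)                                        ≡⟨ count-vertices P ⟩
  count (P ∘ u) (allFin n) + count (P ∘ v) (allFin n)         ≡⟨ cong₂ _+_ (count-permute π (P ∘ u)) (count-permute π (P ∘ v)) ⟩
  count (P ∘ onRims false (π ⟨$⟩ʳ_) ∘ u) (allFin n) + count (P ∘ onRims false (π ⟨$⟩ʳ_) ∘ v) (allFin n)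
                                                              ≡⟨ count-vertices (P ∘ onRims false (π ⟨$⟩ʳ_)) ⟨
  count (P ∘ onRims false (π ⟨$⟩ʳ_)) (vertices n)            ∎
  where open ≡-Reasoning
count-onRims {n} true π P = begin
  count P (vertices n)                                        ≡⟨ count-vertices P ⟩
  count (P ∘ u) (allFin n) + count (P ∘ v) (allFin n)         ≡⟨ +-comm (count (P ∘ u) (allFin n)) _ ⟩
  count (P ∘ v) (allFin n) + count (P ∘ u) (allFin n)         ≡⟨ cong₂ _+_ (count-permute π (P ∘ v)) (count-permute π (P ∘ u)) ⟩
  count (P ∘ onRims true (π ⟨$⟩ʳ_) ∘ u) (allFin n) + count (P ∘ onRims true (π ⟨$⟩ʳ_) ∘ v) (allFin n)
                                                              ≡⟨ count-vertices (P ∘ onRims true (π ⟨$⟩ʳ_)) ⟨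
  count (P ∘ onRims true (π ⟨$⟩ʳ_)) (vertices n)             ∎
  where open ≡-Reasoning

==⇒≡ : ∀ {n} (x y : V n) → T (x == y) → x ≡ y
==⇒≡ (u i) (u j) p = cong u (toℕ-injective (≡ᵇ⇒≡ (toℕ i) (toℕ j) p))
==⇒≡ (v i) (v j) p = cong v (toℕ-injective (≡ᵇ⇒≡ (toℕ i) (toℕ j) p))

==-refl : ∀ {n} (x : V n) → T (x == x)
==-refl (u i) = ≡⇒≡ᵇ (toℕ i) (toℕ i) refl
==-refl (v i) = ≡⇒≡ᵇ (toℕ i) (toℕ i) refl

∈-vertices : ∀ {n} (x : V n) → x ∈ vertices n
∈-vertices (u i) = ∈-++⁺ˡ (∈-map⁺ u (∈-allFin i))
∈-vertices {n} (v i) = ∈-++⁺ʳ (map u (allFin n)) (∈-map⁺ v (∈-allFin i))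

module GP (n k : ℕ) where

  Adjacent : V n → V n → Set
  Adjacent x y = T (adj n k x y)

  -- A record rather than T (reach …) itself, so that ℓ, x and y can be inferred.
  record Reach (ℓ : ℕ) (x y : V n) : Set where
    constructor reaches
    field reached : T (reach n k ℓ x y)
  open Reach public

  spoke : ∀ i → Adjacent (u i) (v i)
  spoke i = ≡⇒≡ᵇ (toℕ i) (toℕ i) refl

  adjacent-sym : ∀ x y → Adjacent x y → Adjacent y x
  adjacent-sym (u i) (u j) a = subst T (∨-comm (shift n 1 i j) _) a
  adjacent-sym (v i) (v j) a = subst T (∨-comm (shift n k i j) _) a
  adjacent-sym (u i) (v j) a = ≡⇒≡ᵇ (toℕ j) (toℕ i) (sym (≡ᵇ⇒≡ (toℕ i) (toℕ j) a))
  adjacent-sym (v i) (u j) a = ≡⇒≡ᵇ (toℕ j) (toℕ i) (sym (≡ᵇ⇒≡ (toℕ i) (toℕ j) a))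

  reach-refl : ∀ x → Reach 0 x x
  reach-refl x = reaches (==-refl x)

  reach-zero⁻ : ∀ {x y} → Reach 0 x y → x ≡ y
  reach-zero⁻ {x} {y} (reaches r) = ==⇒≡ x y r

  reach-suc : ∀ {ℓ x y} → Reach ℓ x y → Reach (suc ℓ) x y
  reach-suc (reaches r) = reaches (∨-introˡ _ r)

  reach-step : ∀ {ℓ x y z} → Reach ℓ x y → Adjacent y z → Reach (suc ℓ) x z
  reach-step {ℓ} {x} {y} {z} (reaches r) a = reaches (∨-introʳ (reach n k ℓ x z)
    (any⁺ _ (lose (∈-vertices y) (Equivalence.from (T-∧ {reach n k ℓ x y}) (r , a)))))

  reach-suc⁻ : ∀ {ℓ x z} → Reach (suc ℓ) x z → Reach ℓ x z ⊎ ∃ λ y → Reach ℓ x y × Adjacent y z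
  reach-suc⁻ {ℓ} {x} {z} (reaches r) with ∨-elim (reach n k ℓ x z) r
  ... | inj₁ r′ = inj₁ (reaches r′)
  ... | inj₂ r′ with satisfied (any⁻ _ (vertices n) r′)
  ...   | y , p with Equivalence.to (T-∧ {reach n k ℓ x y}) p
  ...     | r″ , a = inj₂ (y , reaches r″ , a)

  reach-mono : ∀ {ℓ ℓ′ x y} → ℓ ≤ ℓ′ → Reach ℓ x y → Reach ℓ′ x y
  reach-mono le = go (≤⇒≤′ le)
    where
    go : ∀ {ℓ ℓ′ x y} → ℓ ≤′ ℓ′ → Reach ℓ x y → Reach ℓ′ x y
    go ≤′-refl r = r
    go (≤′-step le) r = reach-suc (go le r)

  reach-++ : ∀ {p} q {x y z} → Reach p x y → Reach q y z → Reach (q + p) x z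
  reach-++ zero r s with reach-zero⁻ s
  ... | refl = r
  reach-++ (suc q) r s with reach-suc⁻ s
  ... | inj₁ s′ = reach-suc (reach-++ q r s′)
  ... | inj₂ (w , s′ , a) = reach-step (reach-++ q r s′) a

  reach-sym : ∀ {ℓ x y} → Reach ℓ x y → Reach ℓ y x
  reach-sym {zero} r with reach-zero⁻ r
  ... | refl = r
  reach-sym {suc ℓ} {x} {y} r with reach-suc⁻ r
  ... | inj₁ r′ = reach-suc (reach-sym r′)
  ... | inj₂ (w , r′ , a) = subst (λ l → Reach l y x) (+-comm ℓ 1)
    (reach-++ ℓ (reach-step (reach-refl y) (adjacent-sym w y a)) (reach-sym r′))

  reach-hom : (φ : V n → V n) → (∀ x y → Adjacent x y → Adjacent (φ x) (φ y)) →
    ∀ {ℓ x y} → Reach ℓ x y → Reach ℓ (φ x) (φ y)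
  reach-hom φ hom {zero} r with reach-zero⁻ r
  ... | refl = reach-refl _
  reach-hom φ hom {suc ℓ} r with reach-suc⁻ r
  ... | inj₁ r′ = reach-suc (reach-hom φ hom r′)
  ... | inj₂ (w , r′ , a) = reach-step (reach-hom φ hom r′) (hom w _ a)

  reach-potential : (f : V n → ℕ) → (∀ x y → Adjacent x y → f y ≤ suc (f x)) →
    ∀ {ℓ x y} → Reach ℓ x y → f y ≤ ℓ + f x
  reach-potential f lip {zero} r with reach-zero⁻ r
  ... | refl = ≤-refl
  reach-potential f lip {suc ℓ} r with reach-suc⁻ r
  ... | inj₁ r′ = m≤n⇒m≤1+n (reach-potential f lip r′)
  ... | inj₂ (w , r′ , a) = ≤-trans (lip w _ a) (s≤s (reach-potential f lip r′))

  firstReach-cong : ∀ {x y x′ y′} → (∀ ℓ → reach n k ℓ x y ≡ reach n k ℓ x′ y′) →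
    ∀ s b → firstReach n k s b x y ≡ firstReach n k s b x′ y′
  firstReach-cong {x} {y} {x′} {y′} E s zero with reach n k s x y | reach n k s x′ y′ | E s
  ... | true  | .true  | refl = refl
  ... | false | .false | refl = refl
  firstReach-cong {x} {y} {x′} {y′} E s (suc b) with reach n k s x y | reach n k s x′ y′ | E s
  ... | true  | .true  | refl = refl
  ... | false | .false | refl = firstReach-cong E (suc s) b

  firstReach-≤ : ∀ {x y} s b {ℓ} → Reach ℓ x y → s ≤ ℓ → ℓ ≤ s + b → firstReach n k s b x y ≤ ℓ
  firstReach-≤ {x} {y} s zero {ℓ} r s≤ℓ ℓ≤s with reach n k s x y in eq
  ... | true = s≤ℓ
  ... | false = ⊥-elim (subst T eq (reached (subst (λ l → Reach l x y) ℓ≡s r)))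
    where ℓ≡s = ≤-antisym (subst (ℓ ≤_) (+-identityʳ s) ℓ≤s) s≤ℓ
  firstReach-≤ {x} {y} s (suc b) {ℓ} r s≤ℓ ℓ≤s with reach n k s x y in eq
  ... | true = s≤ℓ
  ... | false with m≤n⇒m<n∨m≡n s≤ℓ
  ...   | inj₁ s<ℓ = firstReach-≤ (suc s) b r s<ℓ (subst (ℓ ≤_) (+-suc s b) ℓ≤s)
  ...   | inj₂ refl = ⊥-elim (subst T eq (reached r))

  ≤-firstReach : ∀ {x y q} s b → (∀ ℓ → Reach ℓ x y → q ≤ ℓ) → q ≤ suc (s + b) →
    q ≤ firstReach n k s b x y
  ≤-firstReach {x} {y} {q} s zero H q≤ with reach n k s x y in eq
  ... | true = H s (reaches (Equivalence.from T-≡ eq))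
  ... | false = subst (λ t → q ≤ suc t) (+-identityʳ s) q≤
  ≤-firstReach {x} {y} {q} s (suc b) H q≤ with reach n k s x y in eq
  ... | true = H s (reaches (Equivalence.from T-≡ eq))
  ... | false = ≤-firstReach (suc s) b H (subst (λ t → q ≤ suc t) (+-suc s b) q≤)

  dist-≤ : ∀ {x y ℓ} → Reach ℓ x y → ℓ ≤ 2 * n → dist n k x y ≤ ℓ
  dist-≤ r le = firstReach-≤ 0 (2 * n) r z≤n le

  ≤-dist : ∀ {x y q} → (∀ ℓ → Reach ℓ x y → q ≤ ℓ) → q ≤ suc (2 * n) → q ≤ dist n k x y
  ≤-dist = ≤-firstReach 0 (2 * n)

  dist-cong : ∀ {x y x′ y′} → (∀ {ℓ} → Reach ℓ x y → Reach ℓ x′ y′) → (∀ {ℓ} → Reach ℓ x′ y′ → Reach ℓ x y) →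
    dist n k x y ≡ dist n k x′ y′
  dist-cong f g = firstReach-cong (λ ℓ → T-injective (reached ∘ f {ℓ} ∘ reaches) (reached ∘ g {ℓ} ∘ reaches)) 0 (2 * n)

  dist-sym : ∀ x y → dist n k x y ≡ dist n k y x
  dist-sym x y = dist-cong reach-sym reach-sym

  dist≤diameter : ∀ x y → dist n k x y ≤ diameter n k
  dist≤diameter x y = ≤-maxℕ (∈-concatMap⁺ (λ z → map (dist n k z) (vertices n))
    (lose (∈-vertices x) (∈-map⁺ (dist n k x) (∈-vertices y))))
    where
    ≤-maxℕ : ∀ {a xs} → a ∈ xs → a ≤ maxℕ xs
    ≤-maxℕ {xs = x ∷ xs} (here refl) = m≤m⊔n x (maxℕ xs)
    ≤-maxℕ {xs = x ∷ xs} (there p) = ≤-trans (≤-maxℕ p) (m≤n⊔m x (maxℕ xs))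

  -- All the symmetries we need act by one involution σ of the indices on both rims, possibly
  -- exchanging the rims.
  record Involution : Set where
    field
      exchangesRims : Bool
      σ : Fin n → Fin n
      σ-involutive : ∀ i → σ (σ i) ≡ i
      onRims-adjacent : ∀ x y → Adjacent x y → Adjacent (onRims exchangesRims σ x) (onRims exchangesRims σ y)

    act : V n → V n
    act = onRims exchangesRims σ

    act-involutive : ∀ x → act (act x) ≡ x
    act-involutive x with exchangesRims | x
    ... | false | u i = cong u (σ-involutive i)
    ... | false | v i = cong v (σ-involutive i)
    ... | true  | u i = cong u (σ-involutive i)
    ... | true  | v i = cong v (σ-involutive i)

    dist-act : ∀ x y → dist n k (act x) (act y) ≡ dist n k x y
    dist-act x y = dist-cong
      (λ r → subst₂ (Reach _) (act-involutive x) (act-involutive y) (reach-hom act onRims-adjacent r))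
      (reach-hom act onRims-adjacent)

    W-act : ∀ x y → W n k (act x) (act y) ≡ W n k x y
    W-act x y = begin
      count (λ w → dist n k (act x) w <ᵇ dist n k (act y) w) (vertices n)
        ≡⟨ count-onRims exchangesRims (permutation σ σ σ-involutive σ-involutive) _ ⟩
      count (λ w → dist n k (act x) (act w) <ᵇ dist n k (act y) (act w)) (vertices n)
        ≡⟨ count-cong (λ w → cong₂ _<ᵇ_ (dist-act x w) (dist-act y w)) (vertices n) ⟩
      W n k x y ∎
      where open ≡-Reasoning

    W-swap : ∀ x {y} → act x ≡ y → W n k x y ≡ W n k y x
    W-swap x refl = begin
      W n k x (act x)             ≡⟨ W-act x (act x) ⟨
      W n k (act x) (act (act x)) ≡⟨ cong (W n k (act x)) (act-involutive x) ⟩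
      W n k (act x) x             ∎
      where open ≡-Reasoning

module Modular (n′ : ℕ) where

  N : ℕ
  N = suc n′

  infix 4 _≈_
  record _≈_ (a b : ℕ) : Set where
    constructor mod-eq
    field %-≡ : a % N ≡ b % N

  ≈-refl : ∀ {a} → a ≈ a
  ≈-refl = mod-eq refl

  ≈-sym : ∀ {a b} → a ≈ b → b ≈ a
  ≈-sym (mod-eq p) = mod-eq (sym p)

  ≈-trans : ∀ {a b c} → a ≈ b → b ≈ c → a ≈ c
  ≈-trans (mod-eq p) (mod-eq q) = mod-eq (trans p q)

  ≈-setoid : Setoid _ _
  ≈-setoid = record
    { Carrier = ℕ ; _≈_ = _≈_
    ; isEquivalence = record { refl = ≈-refl ; sym = ≈-sym ; trans = ≈-trans } }

  module ≈-Reasoning = SetoidReasoning ≈-setoid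

  ≡⇒≈ : ∀ {a b} → a ≡ b → a ≈ b
  ≡⇒≈ refl = ≈-refl

  +-cong : ∀ {a a′ b b′} → a ≈ a′ → b ≈ b′ → a + b ≈ a′ + b′
  +-cong {a} {a′} {b} {b′} (mod-eq p) (mod-eq q) = mod-eq (begin
    (a + b) % N               ≡⟨ %-distribˡ-+ a b N ⟩
    (a % N + b % N) % N       ≡⟨ cong₂ (λ x y → (x + y) % N) p q ⟩
    (a′ % N + b′ % N) % N     ≡⟨ %-distribˡ-+ a′ b′ N ⟨
    (a′ + b′) % N             ∎)
    where open ≡-Reasoning

  *-cong : ∀ {a a′ b b′} → a ≈ a′ → b ≈ b′ → a * b ≈ a′ * b′
  *-cong {a} {a′} {b} {b′} (mod-eq p) (mod-eq q) = mod-eq (begin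
    (a * b) % N               ≡⟨ %-distribˡ-* a b N ⟩
    (a % N * (b % N)) % N     ≡⟨ cong₂ (λ x y → (x * y) % N) p q ⟩
    (a′ % N * (b′ % N)) % N   ≡⟨ %-distribˡ-* a′ b′ N ⟨
    (a′ * b′) % N             ∎)
    where open ≡-Reasoning

  +-congˡ : ∀ a {b b′} → b ≈ b′ → a + b ≈ a + b′
  +-congˡ a = +-cong (≈-refl {a})

  +-congʳ : ∀ {a a′} b → a ≈ a′ → a + b ≈ a′ + b
  +-congʳ b p = +-cong p (≈-refl {b})

  *-congˡ : ∀ a {b b′} → b ≈ b′ → a * b ≈ a * b′
  *-congˡ a = *-cong (≈-refl {a})

  ≈-by-multiple : ∀ {a b} r → a ≡ b + r * N → a ≈ b
  ≈-by-multiple {b = b} r refl = mod-eq ([m+kn]%n≡m%n b r N)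

  toℕ-mod : ∀ a → toℕ (a mod N) ≈ a
  toℕ-mod a = mod-eq (trans (cong (_% N) (toℕ-fromℕ< (m%n<n a N))) (m%n%n≡m%n a N))

  toℕ-≈-injective : ∀ {i j : Fin N} → toℕ i ≈ toℕ j → i ≡ j
  toℕ-≈-injective {i} {j} (mod-eq p) =
    toℕ-injective (trans (sym (m<n⇒m%n≡m (toℕ<n i))) (trans p (m<n⇒m%n≡m (toℕ<n j))))

  mod-≈ : ∀ {a} {j : Fin N} → a ≈ toℕ j → a mod N ≡ j
  mod-≈ {a} p = toℕ-≈-injective (≈-trans (toℕ-mod a) p)

  mod-toℕ : ∀ (i : Fin N) → toℕ i mod N ≡ i
  mod-toℕ i = mod-≈ ≈-refl

  shift-intro : ∀ t (i j : Fin N) → toℕ i + t ≈ toℕ j → T (shift N t i j)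
  shift-intro t i j (mod-eq p) = ≡⇒≡ᵇ _ _ (trans p (m<n⇒m%n≡m (toℕ<n j)))

  shift-elim : ∀ t (i j : Fin N) → T (shift N t i j) → toℕ i + t ≈ toℕ j
  shift-elim t i j p = mod-eq (trans (≡ᵇ⇒≡ _ _ p) (sym (m<n⇒m%n≡m (toℕ<n j))))

BalancedAtU₀ : ℕ → ℕ → Set
BalancedAtU₀ n′ k = ∀ j → dist (suc n′) k (u fzero) (v j) ≡ diameter (suc n′) k →
  W (suc n′) k (u fzero) (v j) ≡ W (suc n′) k (v j) (u fzero)

module Cyclic (n′ k : ℕ) where
  open Modular n′ public
  open GP N k public

  Step : ℕ → Fin N → Fin N → Set
  Step s i j = T (shift N s i j ∨ shift N s j i)

  Step-sym : ∀ s i j → Step s i j → Step s j i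
  Step-sym s i j = subst T (∨-comm (shift N s i j) _)

  -- Multiplication by e sends the steps ±s to the steps ±t.
  MapsStep : ℕ → ℕ → ℕ → Set
  MapsStep e s t = e * s ≈ t ⊎ e * s + t ≈ 0

  affine : ℕ → ℕ → Fin N → Fin N
  affine c e i = (c + e * toℕ i) mod N

  affine-shift : ∀ c e {s t} → MapsStep e s t → ∀ (a b : Fin N) → toℕ a + s ≈ toℕ b →
    Step t (affine c e a) (affine c e b)
  affine-shift c e {s} {t} (inj₁ es≈t) a b a+s≈b = ∨-introˡ _ (shift-intro t _ _ (begin
    toℕ (affine c e a) + t     ≈⟨ +-cong (toℕ-mod _) (≈-sym es≈t) ⟩
    c + e * toℕ a + e * s      ≡⟨ distribute c e (toℕ a) s ⟩
    c + e * (toℕ a + s)        ≈⟨ +-congˡ c (*-congˡ e a+s≈b) ⟩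
    c + e * toℕ b              ≈⟨ toℕ-mod _ ⟨
    toℕ (affine c e b)         ∎))
    where
    open ≈-Reasoning
    distribute : ∀ c e a s → c + e * a + e * s ≡ c + e * (a + s)
    distribute = solve-∀
  affine-shift c e {s} {t} (inj₂ es+t≈0) a b a+s≈b = ∨-introʳ (shift N t (affine c e a) (affine c e b))
    (shift-intro t _ _ (begin
    toℕ (affine c e b) + t     ≈⟨ +-congʳ t (toℕ-mod _) ⟩
    c + e * toℕ b + t          ≈⟨ +-congʳ t (+-congˡ c (*-congˡ e a+s≈b)) ⟨
    c + e * (toℕ a + s) + t    ≡⟨ regroup c e (toℕ a) s t ⟩
    c + e * toℕ a + (e * s + t) ≈⟨ +-congˡ (c + e * toℕ a) es+t≈0 ⟩
    c + e * toℕ a + 0          ≡⟨ +-identityʳ _ ⟩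
    c + e * toℕ a              ≈⟨ toℕ-mod _ ⟨
    toℕ (affine c e a)         ∎))
    where
    open ≈-Reasoning
    regroup : ∀ c e a s t → c + e * (a + s) + t ≡ c + e * a + (e * s + t)
    regroup = solve-∀

  affine-step : ∀ c e {s t} → MapsStep e s t → ∀ i j → Step s i j → Step t (affine c e i) (affine c e j)
  affine-step c e {s} {t} steps i j st with ∨-elim (shift N s i j) st
  ... | inj₁ i→j = affine-shift c e steps i j (shift-elim s i j i→j)
  ... | inj₂ j→i = Step-sym t (affine c e j) (affine c e i) (affine-shift c e steps j i (shift-elim s j i j→i))

  affine-involutive : ∀ c e → c + e * c ≈ 0 → e * e ≈ 1 → ∀ i → affine c e (affine c e i) ≡ i
  affine-involutive c e c+ec≈0 e²≈1 i = mod-≈ (begin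
    c + e * toℕ (affine c e i)     ≈⟨ +-congˡ c (*-congˡ e (toℕ-mod _)) ⟩
    c + e * (c + e * toℕ i)        ≡⟨ expand c e (toℕ i) ⟩
    (c + e * c) + (e * e) * toℕ i  ≈⟨ +-cong c+ec≈0 (*-cong e²≈1 (≈-refl {toℕ i})) ⟩
    1 * toℕ i                      ≡⟨ *-identityˡ (toℕ i) ⟩
    toℕ i                          ∎)
    where
    open ≈-Reasoning
    expand : ∀ c e i → c + e * (c + e * i) ≡ (c + e * c) + (e * e) * i
    expand = solve-∀

  spoke-respects : (σ : Fin N → Fin N) → ∀ {i j} → T (toℕ i ≡ᵇ toℕ j) → T (toℕ (σ i) ≡ᵇ toℕ (σ j))
  spoke-respects σ {i} {j} p rewrite toℕ-injective {i = i} {j} (≡ᵇ⇒≡ _ _ p) = spoke (σ j)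

  affine-adjacent : ∀ exchange c e →
    MapsStep e 1 (if exchange then k else 1) → MapsStep e k (if exchange then 1 else k) →
    ∀ x y → Adjacent x y → Adjacent (onRims exchange (affine c e) x) (onRims exchange (affine c e) y)
  affine-adjacent false c e s₁ sₖ (u i) (u j) = affine-step c e s₁ i j
  affine-adjacent false c e s₁ sₖ (v i) (v j) = affine-step c e sₖ i j
  affine-adjacent false c e s₁ sₖ (u i) (v j) = spoke-respects (affine c e)
  affine-adjacent false c e s₁ sₖ (v i) (u j) = spoke-respects (affine c e)
  affine-adjacent true  c e s₁ sₖ (u i) (u j) = affine-step c e s₁ i j
  affine-adjacent true  c e s₁ sₖ (v i) (v j) = affine-step c e sₖ i j
  affine-adjacent true  c e s₁ sₖ (u i) (v j) = spoke-respects (affine c e)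
  affine-adjacent true  c e s₁ sₖ (v i) (u j) = spoke-respects (affine c e)

  affineInvolution : ∀ exchange c e → c + e * c ≈ 0 → e * e ≈ 1 →
    MapsStep e 1 (if exchange then k else 1) → MapsStep e k (if exchange then 1 else k) → Involution
  affineInvolution exchange c e c+ec≈0 e²≈1 s₁ sₖ = record
    { exchangesRims   = exchange
    ; σ               = affine c e
    ; σ-involutive    = affine-involutive c e c+ec≈0 e²≈1
    ; onRims-adjacent = affine-adjacent exchange c e s₁ sₖ
    }

  BalancedAt : ℕ → Set
  BalancedAt j = W N k (u fzero) (v (j mod N)) ≡ W N k (v (j mod N)) (u fzero)

  balanced-by-exchange : ∀ e j → MapsStep e 1 k → MapsStep e k 1 → e * e ≈ 1 → j + e * j ≈ 0 → BalancedAt j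
  balanced-by-exchange e j s₁ sₖ e²≈1 j+ej≈0 =
    Involution.W-swap (affineInvolution true j e j+ej≈0 e²≈1 s₁ sₖ) (u fzero)
      (cong (λ a → v (a mod N)) (trans (cong (j +_) (*-zeroʳ e)) (+-identityʳ j)))

  -- n′ = N - 1 acts as -1.
  negation-maps-step : ∀ s → MapsStep n′ s s
  negation-maps-step s = inj₂ (≈-by-multiple s (identity n′ s))
    where
    identity : ∀ n′ s → n′ * s + s ≡ 0 + s * suc n′
    identity = solve-∀

  negation-squared : n′ * n′ ≈ 1
  negation-squared = mod-eq (m*m%[1+m]≡1%[1+m] n′)

  negation-involutive : ∀ c → c + n′ * c ≈ 0
  negation-involutive c = ≈-by-multiple c (identity n′ c)
    where
    identity : ∀ n′ c → c + n′ * c ≡ 0 + c * suc n′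
    identity = solve-∀

  reflection : ℕ → Involution
  reflection c = affineInvolution false c n′ (negation-involutive c) negation-squared
    (negation-maps-step 1) (negation-maps-step k)

  reflect : ∀ {c} (i j : Fin N) → c ≈ toℕ i + toℕ j → affine c n′ i ≡ j
  reflect {c} i j c≈i+j = mod-≈ (begin
    c + n′ * toℕ i               ≈⟨ +-congʳ (n′ * toℕ i) c≈i+j ⟩
    toℕ i + toℕ j + n′ * toℕ i   ≡⟨ identity n′ (toℕ i) (toℕ j) ⟩
    toℕ j + toℕ i * N            ≈⟨ ≈-by-multiple (toℕ i) refl ⟩
    toℕ j                        ∎)
    where
    open ≈-Reasoning
    identity : ∀ n′ i j → i + j + n′ * i ≡ j + i * suc n′
    identity = solve-∀

  W-u-u : ∀ a b → W N k (u a) (u b) ≡ W N k (u b) (u a)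
  W-u-u a b = Involution.W-swap (reflection (toℕ a + toℕ b)) (u a) (cong u (reflect a b ≈-refl))

  W-v-v : ∀ a b → W N k (v a) (v b) ≡ W N k (v b) (v a)
  W-v-v a b = Involution.W-swap (reflection (toℕ a + toℕ b)) (v a) (cong v (reflect a b ≈-refl))

  balanced-via-u₀ : BalancedAtU₀ n′ k →
    ∀ a b → dist N k (u a) (v b) ≡ diameter N k → W N k (u a) (v b) ≡ W N k (v b) (u a)
  balanced-via-u₀ at-u₀ a b d = begin
    W N k (u a) (v b)              ≡⟨ W-act (u a) (v b) ⟨
    W N k (u (ρ a)) (v (ρ b))      ≡⟨ cong (λ i → W N k (u i) (v (ρ b))) a↦0 ⟩
    W N k (u fzero) (v (ρ b))      ≡⟨ at-u₀ (ρ b) d₀ ⟩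
    W N k (v (ρ b)) (u fzero)      ≡⟨ cong (λ i → W N k (v (ρ b)) (u i)) a↦0 ⟨
    W N k (v (ρ b)) (u (ρ a))      ≡⟨ W-act (v b) (u a) ⟩
    W N k (v b) (u a)              ∎
    where
    open Involution (reflection (toℕ a))
    open ≡-Reasoning
    ρ : Fin N → Fin N
    ρ = affine (toℕ a) n′
    a↦0 : ρ a ≡ fzero
    a↦0 = reflect a fzero (≡⇒≈ (sym (+-identityʳ (toℕ a))))
    d₀ : dist N k (u fzero) (v (ρ b)) ≡ diameter N k
    d₀ = trans (cong (λ i → dist N k (u i) (v (ρ b))) (sym a↦0)) (trans (dist-act (u a) (v b)) d)

  reach-outer : ∀ t → Reach t (u fzero) (u (t mod N))
  reach-outer zero = reach-refl _
  reach-outer (suc t) = reach-step (reach-outer t) (∨-introˡ _ (shift-intro 1 _ _ (begin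
    toℕ (t mod N) + 1   ≈⟨ +-congʳ 1 (toℕ-mod t) ⟩
    t + 1               ≡⟨ +-comm t 1 ⟩
    suc t               ≈⟨ toℕ-mod (suc t) ⟨
    toℕ (suc t mod N)   ∎)))
    where open ≈-Reasoning

  reach-outer⁻ : ∀ t → Reach t (u fzero) (u ((t * n′) mod N))
  reach-outer⁻ zero = reach-refl _
  reach-outer⁻ (suc t) = reach-step (reach-outer⁻ t) (∨-introʳ (shift N 1 ((t * n′) mod N) _) (shift-intro 1 _ _ (begin
    toℕ ((suc t * n′) mod N) + 1   ≈⟨ +-congʳ 1 (toℕ-mod (suc t * n′)) ⟩
    suc t * n′ + 1                 ≈⟨ ≈-by-multiple 1 (identity n′ t) ⟩
    t * n′                         ≈⟨ toℕ-mod (t * n′) ⟨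
    toℕ ((t * n′) mod N)           ∎)))
    where
    open ≈-Reasoning
    identity : ∀ n′ t → suc t * n′ + 1 ≡ t * n′ + 1 * suc n′
    identity = solve-∀

  reach-from-u₀ : ∀ x → Reach N (u fzero) x
  reach-from-u₀ (u i) = reach-mono (m≤n⇒m≤1+n (≤-pred (toℕ<n i)))
    (subst (λ j → Reach (toℕ i) (u fzero) (u j)) (mod-toℕ i) (reach-outer (toℕ i)))
  reach-from-u₀ (v i) = reach-mono (toℕ<n i) (reach-step
    (subst (λ j → Reach (toℕ i) (u fzero) (u j)) (mod-toℕ i) (reach-outer (toℕ i))) (spoke i))

  connected : Connected N k
  connected x y = Equivalence.to T-≡ (reached (reach-mono (≤-reflexive (cong (N +_) (sym (+-identityʳ N))))
    (reach-++ N (reach-sym (reach-from-u₀ x)) (reach-from-u₀ y))))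

  dist-mirror : ∀ j j′ → j + j′ ≡ N → dist N k (u fzero) (v (j mod N)) ≡ dist N k (u fzero) (v (j′ mod N))
  dist-mirror j j′ j+j′≡N =
    trans (sym (cong₂ (λ a b → dist N k (u a) (v b)) 0↦0 j′↦j)) (dist-act (u fzero) (v (j′ mod N)))
    where
    open Involution (reflection 0)
    open ≈-Reasoning
    0↦0 : affine 0 n′ fzero ≡ fzero
    0↦0 = reflect fzero fzero ≈-refl
    j′↦j : affine 0 n′ (j′ mod N) ≡ j mod N
    j′↦j = reflect (j′ mod N) (j mod N) (≈-sym (begin
      toℕ (j′ mod N) + toℕ (j mod N)  ≈⟨ +-cong (toℕ-mod j′) (toℕ-mod j) ⟩
      j′ + j                          ≡⟨ trans (+-comm j′ j) j+j′≡N ⟩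
      N                               ≈⟨ ≈-by-multiple 1 (sym (*-identityˡ N)) ⟩
      0                               ∎))

  balanced-at-u₀-of-mod : (∀ j → j < N → dist N k (u fzero) (v (j mod N)) ≡ diameter N k → BalancedAt j) →
    BalancedAtU₀ n′ k
  balanced-at-u₀-of-mod balanced j d = subst (λ i → W N k (u fzero) (v i) ≡ W N k (v i) (u fzero)) (mod-toℕ j)
    (balanced (toℕ j) (toℕ<n j) (trans (cong (λ i → dist N k (u fzero) (v i)) (mod-toℕ j)) d))

prism-balanced : ∀ n′ → BalancedAtU₀ n′ 1
prism-balanced n′ = balanced-at-u₀-of-mod λ j _ _ →
  balanced-by-exchange n′ j (negation-maps-step 1) (negation-maps-step 1) negation-squared (negation-involutive j)
  where open Cyclic n′ 1

-- GP(4m, 2m - 1) for m = m₁ + 1.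
module Family (m₁ : ℕ) where

  n′ k : ℕ
  n′ = 3 + 4 * m₁
  k = 1 + 2 * m₁

  open Cyclic n′ k

  m : ℕ
  m = suc m₁

  M : ℕ
  M = 2 + 2 * m₁

  M∣N : M ∣ N
  M∣N = divides 2 (identity m₁)
    where
    identity : ∀ m₁ → 4 + 4 * m₁ ≡ 2 * (2 + 2 * m₁)
    identity = solve-∀

  ≈⇒%M : ∀ {a b} → a ≈ b → a % M ≡ b % M
  ≈⇒%M {a} {b} (mod-eq p) = trans (sym (m∣n⇒o%n%m≡o%m M N a M∣N)) (trans (cong (_% M) p) (m∣n⇒o%n%m≡o%m M N b M∣N))

  -- Reducing indices modulo 2m maps GP(4m, 2m - 1) onto the prism over a 2m-cycle, in which the
  -- inner step k becomes -1; the potential is the distance from u₀ in that prism.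
  potential : V N → ℕ
  potential (u i) = cyclicNorm M (toℕ i % M)
  potential (v i) = suc (cyclicNorm M (toℕ i % M))

  near-% : ∀ r s → (r + 1) % M ≡ s % M → Near (cyclicNorm M (r % M)) (cyclicNorm M (s % M))
  near-% r s eq = subst (λ y → Near (cyclicNorm M (r % M)) (cyclicNorm M y))
    (trans (cong (_% M) (+-comm 1 r)) eq) (cyclicNorm-%-suc M r)

  near-outer : ∀ (i j : Fin N) → toℕ i + 1 ≈ toℕ j → Near (cyclicNorm M (toℕ i % M)) (cyclicNorm M (toℕ j % M))
  near-outer i j i+1≈j = near-% (toℕ i) (toℕ j) (≈⇒%M i+1≈j)

  near-inner : ∀ (i j : Fin N) → toℕ i + k ≈ toℕ j → Near (cyclicNorm M (toℕ j % M)) (cyclicNorm M (toℕ i % M))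
  near-inner i j i+k≈j = near-% (toℕ j) (toℕ i) (begin
    (toℕ j + 1) % M        ≡⟨ ≈⇒%M (+-congʳ 1 i+k≈j) ⟨
    (toℕ i + k + 1) % M    ≡⟨ cong (_% M) (identity m₁ (toℕ i)) ⟩
    (toℕ i + 1 * M) % M    ≡⟨ [m+kn]%n≡m%n (toℕ i) 1 M ⟩
    toℕ i % M              ∎)
    where
    open ≡-Reasoning
    identity : ∀ m₁ i → i + (1 + 2 * m₁) + 1 ≡ i + 1 * (2 + 2 * m₁)
    identity = solve-∀

  potential-lipschitz : ∀ x y → Adjacent x y → potential y ≤ suc (potential x)
  potential-lipschitz (u i) (u j) a with ∨-elim (shift N 1 i j) a
  ... | inj₁ i→j = proj₂ (near-outer i j (shift-elim 1 i j i→j))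
  ... | inj₂ j→i = proj₁ (near-outer j i (shift-elim 1 j i j→i))
  potential-lipschitz (v i) (v j) a with ∨-elim (shift N k i j) a
  ... | inj₁ i→j = s≤s (proj₁ (near-inner i j (shift-elim k i j i→j)))
  ... | inj₂ j→i = s≤s (proj₂ (near-inner j i (shift-elim k j i j→i)))
  potential-lipschitz (u i) (v j) a with toℕ-injective {i = i} {j} (≡ᵇ⇒≡ _ _ a)
  ... | refl = ≤-refl
  potential-lipschitz (v i) (u j) a with toℕ-injective {i = i} {j} (≡ᵇ⇒≡ _ _ a)
  ... | refl = m≤n⇒m≤1+n (n≤1+n _)

  potential-v-m : potential (v (m mod N)) ≡ suc m
  potential-v-m = cong suc (begin
    cyclicNorm M (toℕ (m mod N) % M)  ≡⟨ cong (λ y → cyclicNorm M (y % M)) (toℕ-fromℕ< (m%n<n m N)) ⟩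
    cyclicNorm M (m % N % M)          ≡⟨ cong (λ y → cyclicNorm M (y % M)) (m<n⇒m%n≡m m<N) ⟩
    cyclicNorm M (m % M)              ≡⟨ cong (cyclicNorm M) (m<n⇒m%n≡m m<M) ⟩
    m ⊓ (M ∸ m)                       ≡⟨ cong (λ y → m ⊓ (y ∸ m)) (M≡m+m m₁) ⟩
    m ⊓ (m + m ∸ m)                   ≡⟨ cong (m ⊓_) (m+n∸m≡n m m) ⟩
    m ⊓ m                             ≡⟨ ⊓-idem m ⟩
    m                                 ∎)
    where
    open ≡-Reasoning
    M≡m+m : ∀ m₁ → 2 + 2 * m₁ ≡ suc m₁ + suc m₁
    M≡m+m = solve-∀
    m<M : m < M
    m<M = s≤s (s≤s (m≤m+n m₁ _))
    m<N : m < N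
    m<N = ≤-trans m<M (∣⇒≤ M∣N)

  m≤2N : m ≤ 2 * N
  m≤2N = subst (m ≤_) (sym (identity m₁)) (m≤m+n m (7 + 7 * m₁))
    where
    identity : ∀ m₁ → 2 * (4 + 4 * m₁) ≡ suc m₁ + (7 + 7 * m₁)
    identity = solve-∀

  m<diameter : m < diameter N k
  m<diameter = ≤-trans (≤-dist far (s≤s m≤2N)) (dist≤diameter (u fzero) (v (m mod N)))
    where
    far : ∀ ℓ → Reach ℓ (u fzero) (v (m mod N)) → suc m ≤ ℓ
    far ℓ r = subst₂ _≤_ potential-v-m (+-identityʳ ℓ) (reach-potential potential potential-lipschitz r)

  within-m : ∀ {ℓ} x → Reach ℓ (u fzero) x → ℓ ≤ m → dist N k (u fzero) x ≤ m
  within-m x r ℓ≤m = ≤-trans (dist-≤ r (≤-trans ℓ≤m m≤2N)) ℓ≤m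

  dist-forward : ∀ j → j ≤ m₁ → dist N k (u fzero) (v (j mod N)) ≤ m
  dist-forward j j≤m₁ = within-m (v (j mod N)) (reach-step (reach-outer j) (spoke (j mod N))) (s≤s j≤m₁)

  dist-backward : ∀ j t → j + t ≡ k → suc t ≤ m₁ → dist N k (u fzero) (v (j mod N)) ≤ m
  dist-backward j t j+t≡k st≤m₁ =
    within-m (v (j mod N))
      (reach-step {y = v ((t * n′) mod N)} (reach-step (reach-outer⁻ t) (spoke ((t * n′) mod N))) inner)
      (s≤s st≤m₁)
    where
    open ≈-Reasoning
    identity : ∀ n′ t j → t * n′ + (j + t) ≡ j + t * suc n′
    identity = solve-∀
    inner : Adjacent (v ((t * n′) mod N)) (v (j mod N))
    inner = ∨-introˡ _ (shift-intro k _ _ (begin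
      toℕ ((t * n′) mod N) + k  ≈⟨ +-congʳ k (toℕ-mod (t * n′)) ⟩
      t * n′ + k                ≡⟨ cong (t * n′ +_) (sym j+t≡k) ⟩
      t * n′ + (j + t)          ≡⟨ identity n′ t j ⟩
      j + t * N                 ≈⟨ ≈-by-multiple t refl ⟩
      j                         ≈⟨ toℕ-mod j ⟨
      toℕ (j mod N)             ∎))

  dist-up-to-k : ∀ j → j ≤ k → j ≢ m → dist N k (u fzero) (v (j mod N)) ≤ m
  dist-up-to-k j j≤k j≢m with j ≤? m₁
  ... | yes j≤m₁ = dist-forward j j≤m₁
  ... | no j≰m₁ with m≤n⇒m<n∨m≡n (≰⇒> j≰m₁)
  ...   | inj₂ m≡j = ⊥-elim (j≢m (sym m≡j))
  ...   | inj₁ m<j with m≤n⇒∃[o]m+o≡n j≤k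
  ...     | t , j+t≡k = dist-backward j t j+t≡k (+-cancelˡ-≤ (suc m₁) (suc t) m₁ (begin
    suc m₁ + suc t    ≡⟨ +-suc (suc m₁) t ⟩
    suc m + t         ≤⟨ +-monoˡ-≤ t m<j ⟩
    j + t             ≡⟨ j+t≡k ⟩
    k                 ≡⟨ identity m₁ ⟩
    suc m₁ + m₁       ∎))
    where
    open ≤-Reasoning
    identity : ∀ m₁ → 1 + 2 * m₁ ≡ suc m₁ + m₁
    identity = solve-∀

  dist-u₀-v≤m : ∀ j → j < N → j ≢ m → j ≢ 2 + 2 * m₁ → j ≢ 3 + 3 * m₁ → dist N k (u fzero) (v (j mod N)) ≤ m
  dist-u₀-v≤m j j<N j≢m j≢2m j≢3m with j ≤? k
  ... | yes j≤k = dist-up-to-k j j≤k j≢m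
  ... | no j≰k with m≤n⇒m<n∨m≡n (≰⇒> j≰k) | m≤n⇒∃[o]m+o≡n (<⇒≤ j<N)
  ...   | inj₂ 2m≡j | _ = ⊥-elim (j≢2m (sym (trans (sym (identity₁ m₁)) 2m≡j)))
    where
    identity₁ : ∀ m₁ → 2 + 2 * m₁ ≡ suc (1 + 2 * m₁)
    identity₁ = solve-∀
  ...   | inj₁ 2m<j | j′ , j+j′≡N = subst (_≤ m) (sym (dist-mirror j j′ j+j′≡N)) (dist-up-to-k j′ j′≤k j′≢m)
    where
    open ≤-Reasoning
    identity₂ : ∀ m₁ → 4 + 4 * m₁ ≡ suc (suc (1 + 2 * m₁)) + (1 + 2 * m₁)
    identity₂ = solve-∀
    identity₃ : ∀ m₁ → 4 + 4 * m₁ ≡ (3 + 3 * m₁) + suc m₁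
    identity₃ = solve-∀
    j′≤k : j′ ≤ k
    j′≤k = +-cancelˡ-≤ (suc (suc k)) j′ k (begin
      suc (suc k) + j′  ≤⟨ +-monoˡ-≤ j′ 2m<j ⟩
      j + j′            ≡⟨ trans j+j′≡N (identity₂ m₁) ⟩
      suc (suc k) + k   ∎)
    j′≢m : j′ ≢ m
    j′≢m j′≡m = j≢3m (+-cancelʳ-≡ m j (3 + 3 * m₁)
      (trans (cong (j +_) (sym j′≡m)) (trans j+j′≡N (identity₃ m₁))))

  antipodal : ∀ j → j < N → dist N k (u fzero) (v (j mod N)) ≡ diameter N k →
    j ≡ m ⊎ j ≡ 2 + 2 * m₁ ⊎ j ≡ 3 + 3 * m₁
  antipodal j j<N d with j ≟ m | j ≟ 2 + 2 * m₁ | j ≟ 3 + 3 * m₁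
  ... | yes j≡m | _        | _        = inj₁ j≡m
  ... | no _    | yes j≡2m | _        = inj₂ (inj₁ j≡2m)
  ... | no _    | no _     | yes j≡3m = inj₂ (inj₂ j≡3m)
  ... | no j≢m  | no j≢2m  | no j≢3m  =
    ⊥-elim (1+n≰n (≤-trans m<diameter (subst (_≤ m) d (dist-u₀-v≤m j j<N j≢m j≢2m j≢3m))))

  k²≈1 : k * k ≈ 1
  k²≈1 = ≈-by-multiple m₁ (identity m₁)
    where
    identity : ∀ m₁ → (1 + 2 * m₁) * (1 + 2 * m₁) ≡ 1 + m₁ * (4 + 4 * m₁)
    identity = solve-∀

  balanced-even : ∀ t → BalancedAt (2 * t)
  balanced-even t = balanced-by-exchange k (2 * t) (inj₁ (≡⇒≈ (*-identityʳ k))) (inj₁ k²≈1) k²≈1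
    (≈-by-multiple t (identity m₁ t))
    where
    identity : ∀ m₁ t → 2 * t + (1 + 2 * m₁) * (2 * t) ≡ 0 + t * (4 + 4 * m₁)
    identity = solve-∀

  -- Multiplication by 2m + 1 ≡ -k.
  balanced-by-minus-k : ∀ j r → j * (4 + 2 * m₁) ≡ r * N → BalancedAt j
  balanced-by-minus-k j r eq = balanced-by-exchange (3 + 2 * m₁) j
    (inj₂ (≈-by-multiple 1 (identity₁ m₁))) (inj₂ (≈-by-multiple (1 + m₁) (identity₂ m₁)))
    (≈-by-multiple (2 + m₁) (identity₃ m₁)) (≈-by-multiple r (trans (identity₄ m₁ j) eq))
    where
    identity₁ : ∀ m₁ → (3 + 2 * m₁) * 1 + (1 + 2 * m₁) ≡ 0 + 1 * (4 + 4 * m₁)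
    identity₁ = solve-∀
    identity₂ : ∀ m₁ → (3 + 2 * m₁) * (1 + 2 * m₁) + 1 ≡ 0 + (1 + m₁) * (4 + 4 * m₁)
    identity₂ = solve-∀
    identity₃ : ∀ m₁ → (3 + 2 * m₁) * (3 + 2 * m₁) ≡ 1 + (2 + m₁) * (4 + 4 * m₁)
    identity₃ = solve-∀
    identity₄ : ∀ m₁ j → j + (3 + 2 * m₁) * j ≡ j * (4 + 2 * m₁)
    identity₄ = solve-∀

  balanced-at-m : ∀ t → m₁ ≡ 2 * t → BalancedAt m
  balanced-at-m t m₁≡2t = balanced-by-minus-k m (1 + t)
    (subst (λ x → suc x * (4 + 2 * x) ≡ (1 + t) * (4 + 4 * x)) (sym m₁≡2t) (identity t))
    where
    identity : ∀ t → suc (2 * t) * (4 + 2 * (2 * t)) ≡ (1 + t) * (4 + 4 * (2 * t))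
    identity = solve-∀

  balanced-at-3m : ∀ t → m₁ ≡ 2 * t → BalancedAt (3 + 3 * m₁)
  balanced-at-3m t m₁≡2t = balanced-by-minus-k (3 + 3 * m₁) (3 + 3 * t)
    (subst (λ x → (3 + 3 * x) * (4 + 2 * x) ≡ (3 + 3 * t) * (4 + 4 * x)) (sym m₁≡2t) (identity t))
    where
    identity : ∀ t → (3 + 3 * (2 * t)) * (4 + 2 * (2 * t)) ≡ (3 + 3 * t) * (4 + 4 * (2 * t))
    identity = solve-∀

  balanced-at-antipode : ∀ j → j < N → dist N k (u fzero) (v (j mod N)) ≡ diameter N k → BalancedAt j
  balanced-at-antipode j j<N d with parity j | antipodal j j<N d
  ... | inj₁ (t , refl) | _ = balanced-even t
  ... | inj₂ (t , refl) | inj₁ j≡m = subst BalancedAt (sym j≡m) (balanced-at-m t (sym (suc-injective j≡m)))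
  ... | inj₂ (t , refl) | inj₂ (inj₁ j≡2m) = ⊥-elim (even≢odd (suc m₁) t (trans (identity m₁) (sym j≡2m)))
    where
    identity : ∀ m₁ → 2 * suc m₁ ≡ 2 + 2 * m₁
    identity = solve-∀
  ... | inj₂ (t , refl) | inj₂ (inj₂ j≡3m) with parity m₁
  ...   | inj₁ (q , m₁≡2q) = subst BalancedAt (sym j≡3m) (balanced-at-3m q m₁≡2q)
  ...   | inj₂ (q , m₁≡1+2q) =
    ⊥-elim (even≢odd (3 + 3 * q) t (trans (identity q) (trans (cong (λ x → 3 + 3 * x) (sym m₁≡1+2q)) (sym j≡3m))))
    where
    identity : ∀ q → 2 * (3 + 3 * q) ≡ 3 + 3 * suc (2 * q)
    identity = solve-∀

  balanced : BalancedAtU₀ n′ k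
  balanced = balanced-at-u₀-of-mod balanced-at-antipode

balancedAtU₀? : (n′ k D : ℕ) → Bool
balancedAtU₀? n′ k D = all (λ j → not (dist (suc n′) k (u fzero) (v j) ≡ᵇ D) ∨
  (W (suc n′) k (u fzero) (v j) ≡ᵇ W (suc n′) k (v j) (u fzero))) (allFin (suc n′))

balancedAtU₀?-sound : ∀ n′ k D → T (balancedAtU₀? n′ k D) → diameter (suc n′) k ≡ D → BalancedAtU₀ n′ k
balancedAtU₀?-sound n′ k _ ok refl j d with ∨-elim (not (dist (suc n′) k (u fzero) (v j) ≡ᵇ diameter (suc n′) k))
  (All.lookup (all⁺ _ (allFin (suc n′)) ok) (∈-allFin j))
... | inj₁ far = ⊥-elim (T-not-elim _ far (≡⇒≡ᵇ _ _ d))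
... | inj₂ w   = ≡ᵇ⇒≡ _ _ w

sporadic-balanced : BalancedAtU₀ 4 2 × BalancedAtU₀ 6 2 × BalancedAtU₀ 6 3
sporadic-balanced =
  balancedAtU₀?-sound 4 2 2 _ refl , balancedAtU₀?-sound 6 2 3 _ refl , balancedAtU₀?-sound 6 3 3 _ refl

AntipodeClassification : Set
AntipodeClassification = ∀ (n k : ℕ) → (h : 3 ≤ n) → 2 ≤ k → 2 * k < n →
  Σ (Fin n) (λ j → dist n k (u₀ h) (v j) ≡ diameter n k) →
  Σ ℕ (λ m → 3 ≤ m × n ≡ 4 * m × k ≡ 2 * m ∸ 1)
  ⊎ ((n ≡ 5 × k ≡ 2) ⊎ (n ≡ 7 × k ≡ 2) ⊎ (n ≡ 7 × k ≡ 3))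

balanced-at-u₀ : AntipodeClassification → ∀ p k → 1 ≤ k → 2 * k < 3 + p → BalancedAtU₀ (2 + p) k
balanced-at-u₀ H p (suc zero) _ _ = prism-balanced (2 + p)
balanced-at-u₀ H p k@(suc (suc _)) _ 2k<n j d with H (3 + p) k (s≤s (s≤s (s≤s z≤n))) (s≤s (s≤s z≤n)) 2k<n (j , d)
... | inj₁ (zero , () , _)
... | inj₁ (suc m₁ , _ , n≡4m , k≡2m∸1) = subst₂ BalancedAtU₀ n′≡ k≡ (Family.balanced m₁) j d
  where
  identity : ∀ m₁ → 4 * suc m₁ ≡ suc (3 + 4 * m₁)
  identity = solve-∀
  n′≡ : 3 + 4 * m₁ ≡ 2 + p
  n′≡ = sym (suc-injective (trans n≡4m (identity m₁)))
  k≡ : 1 + 2 * m₁ ≡ k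
  k≡ = sym (trans k≡2m∸1 (+-suc m₁ (m₁ + 0)))
... | inj₂ (inj₁ (refl , refl))          = proj₁ sporadic-balanced j d
... | inj₂ (inj₂ (inj₁ (refl , refl)))   = proj₁ (proj₂ sporadic-balanced) j d
... | inj₂ (inj₂ (inj₂ (refl , refl)))   = proj₂ (proj₂ sporadic-balanced) j d

proposition4p3 : (∀ (n k : ℕ) → (h : 3 ≤ n) → 2 ≤ k → 2 * k < n →
    Σ (Fin n) (λ j → dist n k (u₀ h) (v j) ≡ diameter n k) →
    Σ ℕ (λ m → 3 ≤ m × n ≡ 4 * m × k ≡ 2 * m ∸ 1)
    ⊎ ((n ≡ 5 × k ≡ 2) ⊎ (n ≡ 7 × k ≡ 2) ⊎ (n ≡ 7 × k ≡ 3))) →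
    ∀ (n k : ℕ) → 3 ≤ n → 1 ≤ k → 2 * k < n →
    DistanceBalanced (diameter n k) n k
proposition4p3 H (suc (suc (suc p))) k (s≤s (s≤s (s≤s _))) k≥1 2k<n = connected , ≤-refl , balanced
  where
  open Cyclic (2 + p) k
  at-u₀ : BalancedAtU₀ (2 + p) k
  at-u₀ = balanced-at-u₀ H p k k≥1 2k<n

  balanced : ∀ x y → dist N k x y ≡ diameter N k → W N k x y ≡ W N k y x
  balanced (u a) (u b) _ = W-u-u a b
  balanced (v a) (v b) _ = W-v-v a b
  balanced (u a) (v b) d = balanced-via-u₀ at-u₀ a b d
  balanced (v a) (u b) d = sym (balanced-via-u₀ at-u₀ b a (trans (dist-sym (u b) (v a)) d))
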